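{- An evolutionary network is level-1 if and only if it is 1-nested and no hybrid node of it is the split node of a reticulation cycle.
   Context: An evolutionary network is a rooted directed acyclic graph whose leaves are bijectively labeled by a set of taxa. A tree node is a node of in-degree at most 1; a hybrid node is a node of in-degree at least 2. A reticulation cycle for a hybrid node $h$ is a pair of distinct non-trivial directed paths with a common origin (the split node), both ending in $h$ (the end), that have no intermediate (non-endpoint) nodes in common; the intermediate nodes of the reticulation cycle are the intermediate nodes of these two paths. A network is 1-nested when every pair of reticulation cycles with different ends have disjoint sets of intermediate nodes. A subgraph is biconnected if it is biconnected in the underlying undirected graph (connected, and remains connected after deleting any single node with its incident edges). A network is level-1 when no biconnected subgraph of it contains more than one hybrid node. No restriction on node degrees is imposed. -}

module Defs where

open import Data.Nat using (ℕ)
open import Data.Fin using (Fin)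
open import Data.Bool using (Bool; T)
open import Data.List using (List; []; _∷_; _++_)
open import Data.List.Membership.Propositional using (_∈_)
open import Data.Product using (Σ; ∃; ∃-syntax; _×_; _,_)
open import Data.Sum using (_⊎_)
open import Data.Empty using (⊥)
open import Relation.Nullary using (¬_)
open import Relation.Binary.PropositionalEquality using (_≡_; _≢_)
open import Function.Definitions using (Injective)
open import Level using (0ℓ)

-- Directed graphs on the node set Fin n, given by a Boolean adjacency
-- relation (simple digraphs: at most one arc u → v).

Digraph : ℕ → Set
Digraph n = Fin n → Fin n → Bool

module _ {n : ℕ} (E : Digraph n) where

  Arc : Fin n → Fin n → Set
  Arc u v = T (E u v)

  -- IsPath u xs v : u → x₁ → … → xₖ → v is a directed path whose
  -- intermediate nodes are xs = x₁ … xₖ.  Such a path always has at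
  -- least one arc, i.e. it is non-trivial.
  IsPath : Fin n → List (Fin n) → Fin n → Set
  IsPath u []       v = Arc u v
  IsPath u (x ∷ xs) v = Arc u x × IsPath x xs v

  Acyclic : Set
  Acyclic = ∀ v xs → ¬ IsPath v xs v

  Reachable : Fin n → Fin n → Set
  Reachable u v = u ≡ v ⊎ ∃[ xs ] IsPath u xs v

  IsRoot : Fin n → Set
  IsRoot r = (∀ u → ¬ Arc u r) × (∀ v → Reachable r v)

  IsLeaf : Fin n → Set
  IsLeaf v = ∀ w → ¬ Arc v w

  Hybrid : Fin n → Set
  Hybrid h = Σ (Fin n) λ u → Σ (Fin n) λ u′ → u ≢ u′ × Arc u h × Arc u′ h

  record ReticulationCycle : Set where
    field
      split : Fin n
      end   : Fin n
      path₁ : List (Fin n)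
      path₂ : List (Fin n)
      isPath₁ : IsPath split path₁ end
      isPath₂ : IsPath split path₂ end
      distinct : path₁ ≢ path₂
      disjoint : ∀ x → x ∈ path₁ → x ∈ path₂ → ⊥

    intermediate : List (Fin n)
    intermediate = path₁ ++ path₂

  open ReticulationCycle public

  OneNested : Set
  OneNested = (C D : ReticulationCycle) → end C ≢ end D →
              ∀ x → x ∈ intermediate C → x ∈ intermediate D → ⊥

  NoHybridSplit : Set
  NoHybridSplit = (C : ReticulationCycle) → ¬ Hybrid (split C)

  IsSubgraph : (Fin n → Set) → (Fin n → Fin n → Set) → Set
  IsSubgraph V F = ∀ u v → F u v → Arc u v × V u × V v

  data Walk (ok : Fin n → Set) (F : Fin n → Fin n → Set) : Fin n → Fin n → Set where
    here : ∀ {x} → ok x → Walk ok F x x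
    step : ∀ {x y z} → ok x → (F x y ⊎ F y x) → Walk ok F y z → Walk ok F x z

  Connected : (Fin n → Set) → (Fin n → Fin n → Set) → Set
  Connected ok F = ∀ x y → ok x → ok y → Walk ok F x y

  Biconnected : (Fin n → Set) → (Fin n → Fin n → Set) → Set
  Biconnected V F = Connected V F × (∀ w → Connected (λ x → V x × x ≢ w) F)

  Level1 : Set₁
  Level1 = (V : Fin n → Set) (F : Fin n → Fin n → Set) →
           IsSubgraph V F → Biconnected V F →
           ∀ h h′ → h ≢ h′ → Hybrid h → Hybrid h′ → V h → V h′ → ⊥

record EvolutionaryNetwork : Set where
  field
    n    : ℕ
    E    : Digraph n
    acyclic : Acyclic E
    root : Fin n
    isRoot : IsRoot E root
    m    : ℕ
    label : Fin m → Fin n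
    label-injective : Injective _≡_ _≡_ label
    label-leaf : ∀ i → IsLeaf E (label i)
    label-onto : ∀ v → IsLeaf E v → ∃[ i ] label i ≡ v

module Submission where

-- (⇒) The two branches of a cycle form a biconnected subgraph containing
-- its hybrid end, and also its split.  For a node x intermediate in two
-- cycles with different ends, either x has two parents on them (so x is
-- hybrid, inside the first cycle), or the two cycle subgraphs share x and
-- its parent and their biconnected union contains both ends.
-- (⇐) The zone of a hybrid node h is what is reachable from h or from an
-- intermediate node of a cycle ending at h.  Every arc entering the zone
-- comes from the split of a cycle ending at h, and this entry of h is
-- unique; so a biconnected subgraph cannot join h to a hybrid node outside
-- its zone, and two distinct hybrid nodes never lie in each other's zones.

open import Defs
open import Data.Nat using (ℕ)
open import Function.Bundles using (_⇔_; mk⇔)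
open import Data.Fin using (Fin) renaming (_≟_ to _≟ᶠ_)
open import Data.List using (List; []; _∷_; _++_; [_])
open import Data.List.Properties using (++-conicalˡ)
open import Data.List.Relation.Unary.Any using (here; there)
open import Data.List.Membership.Propositional using (_∈_)
open import Data.List.Membership.Propositional.Properties using (∈-++⁺ˡ; ∈-++⁺ʳ; ∈-++⁻)
open import Data.List.Relation.Binary.Subset.Propositional using (_⊆_)
open import Data.Product using (Σ; _×_; _,_; proj₁; proj₂)
open import Data.Sum using (_⊎_; inj₁; inj₂)
open import Data.Empty using (⊥; ⊥-elim)
open import Relation.Nullary using (¬_; Dec; yes; no)
open import Relation.Nullary.Decidable using (¬¬-excluded-middle)
open import Data.Unit using (⊤; tt)
open import Relation.Binary.PropositionalEquality using (_≡_; _≢_; refl; sym; trans; subst)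
import Data.List.Membership.DecPropositional as DecMembership

module Digraphs {n : ℕ} (E : Digraph n) where
  open DecMembership (_≟ᶠ_ {n}) using (_∈?_)

  Node : Set
  Node = Fin n

  variable
    a b c h h′ p q s t u v w w′ x y z p₁ p₂ x₁ x₂ : Node
    K M xs ys : List Node

  Disjoint : List Node → List Node → Set
  Disjoint A B = ∀ x → x ∈ A → x ∈ B → ⊥

  -- Route a M b: a directed walk from a to b, M listing the nodes visited
  -- after a (M ≡ [] exactly when the walk is trivial and a ≡ b).
  data Route : Node → List Node → Node → Set where
    stop : Route a [] a
    go   : Arc E a b → Route b M c → Route a (b ∷ M) c

  _++ᴿ_ : Route a M b → Route b K c → Route a (M ++ K) c
  stop   ++ᴿ r′ = r′
  go e r ++ᴿ r′ = go e (r ++ᴿ r′)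

  route-[] : Route a [] b → a ≡ b
  route-[] stop = refl

  route-end∈ : Route a M b → b ∈ (a ∷ M)
  route-end∈ stop     = here refl
  route-end∈ (go e r) = there (route-end∈ r)

  Reach : Node → Node → Set
  Reach a b = Σ (List Node) λ M → Route a M b

  reach-refl : Reach a a
  reach-refl = [] , stop

  reach-trans : Reach a b → Reach b c → Reach a c
  reach-trans (M , r) (K , r′) = M ++ K , r ++ᴿ r′

  reach-arc : Arc E a b → Reach a b
  reach-arc e = _ , go e stop

  Reach⁺ : Node → Node → Set
  Reach⁺ a b = Σ Node λ x → Σ (List Node) λ M → Route a (x ∷ M) b

  reach⁺⇒reach : Reach⁺ a b → Reach a b
  reach⁺⇒reach (x , M , r) = x ∷ M , r

  reach⁺-trans : Reach⁺ a b → Reach b c → Reach⁺ a c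
  reach⁺-trans (x , M , r) (K , r′) = x , M ++ K , r ++ᴿ r′

  reach⁺-arc : Arc E a b → Reach⁺ a b
  reach⁺-arc e = _ , [] , go e stop

  route-visit : Route a M b → y ∈ M → Reach⁺ a y × Reach y b
  route-visit (go e r) (here refl) = reach⁺-arc e , (_ , r)
  route-visit (go e r) (there m) with route-visit r m
  ... | a⇝y , y⇝b = reach⁺-trans (reach⁺-arc e) (reach⁺⇒reach a⇝y) , y⇝b

  route-visit₀ : Route a M b → y ∈ (a ∷ M) → Reach a y × Reach y b
  route-visit₀ r (here refl) = reach-refl , (_ , r)
  route-visit₀ r (there m)   = reach⁺⇒reach (proj₁ (route-visit r m)) , proj₂ (route-visit r m)

  route-last : Route a (b ∷ M) v → Σ (List Node) λ M₀ → Σ Node λ p → Route a M₀ p × Arc E p v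
  route-last (go e stop)       = [] , _ , stop , e
  route-last (go e (go e′ r)) with route-last (go e′ r)
  ... | M₀ , p , r₀ , e₀ = _ ∷ M₀ , p , go e r₀ , e₀

  route-cut : Route x M p → t ∈ (x ∷ M) →
              Σ (List Node) λ M′ → Route t M′ p × (∀ y → y ∈ (x ∷ M) → y ∈ M′ ⊎ Reach y t) × M′ ⊆ M
  route-cut {M = M} r (here refl) = M , r , before , λ m → m
    where
    before : ∀ y → y ∈ (_ ∷ M) → y ∈ M ⊎ Reach y _
    before y (here refl) = inj₂ reach-refl
    before y (there m)   = inj₁ m
  route-cut (go e r) (there m) with route-cut r m
  ... | M′ , r′ , before , sub = M′ , r′ , before′ , λ m′ → there (sub m′)
    where
    before′ : ∀ y → y ∈ (_ ∷ _) → y ∈ M′ ⊎ Reach y _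
    before′ y (here refl) = inj₂ (reach-trans (reach-arc e) (proj₁ (route-visit₀ r m)))
    before′ y (there m′)  = before y m′

  data Path : Node → List Node → Node → Set where
    single : Arc E a b → Path a [] b
    cons   : Arc E a x → Path x xs b → Path a (x ∷ xs) b

  toPath : ∀ xs → IsPath E a xs b → Path a xs b
  toPath []       e       = single e
  toPath (x ∷ xs) (e , r) = cons e (toPath xs r)

  fromPath : Path a xs b → IsPath E a xs b
  fromPath (single e) = e
  fromPath (cons e r) = e , fromPath r

  path-last : Path a xs b → Σ Node λ q → Route a xs q × Arc E q b × ((q ≡ a × xs ≡ []) ⊎ q ∈ xs)
  path-last {a} (single e) = a , stop , e , inj₁ (refl , refl)
  path-last (cons e r) with path-last r
  ... | q , r′ , e′ , inj₁ (refl , refl) = q , go e r′ , e′ , inj₂ (here refl)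
  ... | q , r′ , e′ , inj₂ m             = q , go e r′ , e′ , inj₂ (there m)

  route+arc : Route a M q → Arc E q b → Path a M b
  route+arc stop     e′ = single e′
  route+arc (go e r) e′ = cons e (route+arc r e′)

  path⇒route : Path a xs b → Route a (xs ++ [ b ]) b
  path⇒route (single e) = go e stop
  path⇒route (cons e r) = go e (path⇒route r)

  route+path : Route a M s → Path s xs b → Path a (M ++ xs) b
  route+path stop     π = π
  route+path (go e r) π = cons e (route+path r π)

  path+path : Path a xs b → Path b ys c → Path a (xs ++ b ∷ ys) c
  path+path (single e) π = cons e π
  path+path (cons e r) π = cons e (path+path r π)

  path⇒reach⁺ : Path a xs b → Reach⁺ a b
  path⇒reach⁺ (single e) = reach⁺-arc e
  path⇒reach⁺ (cons e r) = reach⁺-trans (reach⁺-arc e) (reach⁺⇒reach (path⇒reach⁺ r))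

  route⇒path : Route a (b ∷ M) c → Σ (List Node) λ xs → IsPath E a xs c
  route⇒path (go e stop)          = [] , e
  route⇒path (go {b = b} e (go e′ r)) with route⇒path (go e′ r)
  ... | xs , π = b ∷ xs , (e , π)

  path-cut : Path s xs b → v ∈ xs →
             Σ (List Node) λ pre → Σ (List Node) λ post →
               Path s pre v × Path v post b × pre ⊆ xs × post ⊆ xs
  path-cut (cons e r) (here refl) = [] , _ , single e , r , (λ ()) , there
  path-cut (cons e r) (there m) with path-cut r m
  ... | pre , post , π₁ , π₂ , sub₁ , sub₂ = _ ∷ pre , post , cons e π₁ , π₂ , sub₁′ , λ m′ → there (sub₂ m′)
    where
    sub₁′ : (_ ∷ pre) ⊆ (_ ∷ _)
    sub₁′ (here refl) = here refl
    sub₁′ (there m′)  = there (sub₁ m′)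

  path-visit : Path a xs b → y ∈ xs → Reach⁺ a y × Reach⁺ y b
  path-visit π m with path-cut π m
  ... | _ , _ , π₁ , π₂ , _ = path⇒reach⁺ π₁ , path⇒reach⁺ π₂

  path-pred : Path s xs b → x ∈ xs → Σ Node λ p → Arc E p x × (p ≡ s ⊎ p ∈ xs)
  path-pred π m with path-cut π m
  ... | pre , _ , π₁ , _ , sub , _ with path-last π₁
  ... | q , _ , e , inj₁ (eq , _) = q , e , inj₁ eq
  ... | q , _ , e , inj₂ qm       = q , e , inj₂ (sub qm)

  path-head : Path s xs b → x ∈ xs → Σ Node λ c → Arc E s c × c ∈ xs × Reach c x
  path-head (cons e r) (here refl) = _ , e , here refl , reach-refl
  path-head (cons e r) (there m)   = _ , e , here refl , reach⁺⇒reach (proj₁ (path-visit r m))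

  FirstHit : Node → List Node → Node → List Node → Set
  FirstHit s xs b S =
    Σ (List Node) λ pre → pre ⊆ xs × Disjoint pre S × (Path s pre b ⊎ Σ Node λ z → z ∈ S × Path s pre z)

  first-hit : Path s xs b → (S : List Node) → FirstHit s xs b S
  first-hit (single e) S = [] , (λ ()) , (λ _ ()) , inj₁ (single e)
  first-hit (cons {x = x} e r) S with x ∈? S
  ... | yes m = [] , (λ ()) , (λ _ ()) , inj₂ (x , m , single e)
  ... | no x∉S with first-hit r S
  ...   | pre , sub , free , hit = x ∷ pre , sub′ , free′ , extend hit
    where
    sub′ : (x ∷ pre) ⊆ (x ∷ _)
    sub′ (here refl) = here refl
    sub′ (there m)   = there (sub m)
    free′ : Disjoint (x ∷ pre) S
    free′ y (here refl) m = x∉S m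
    free′ y (there m)   m′ = free y m m′
    extend : Path x pre _ ⊎ (Σ Node λ z → z ∈ S × Path x pre z) →
             Path _ (x ∷ pre) _ ⊎ (Σ Node λ z → z ∈ S × Path _ (x ∷ pre) z)
    extend (inj₁ π)           = inj₁ (cons e π)
    extend (inj₂ (z , zm , π)) = inj₂ (z , zm , cons e π)

  module _ {ok : Node → Set} {F : Node → Node → Set} where
    walk-start : Walk E ok F x y → ok x
    walk-start (here o)     = o
    walk-start (step o _ _) = o

    walk-end : Walk E ok F x y → ok y
    walk-end (here o)      = o
    walk-end (step _ _ ω)  = walk-end ω

    _++ᵂ_ : Walk E ok F x y → Walk E ok F y z → Walk E ok F x z
    here _     ++ᵂ ω′ = ω′
    step o f ω ++ᵂ ω′ = step o f (ω ++ᵂ ω′)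

    walk-edge : ok x → ok y → F x y ⊎ F y x → Walk E ok F x y
    walk-edge ox oy f = step ox f (here oy)

    walk-reverse : Walk E ok F x y → Walk E ok F y x
    walk-reverse (here o)     = here o
    walk-reverse (step o f ω) = walk-reverse ω ++ᵂ walk-edge (walk-start ω) o (flip f)
      where
      flip : F x y ⊎ F y x → F y x ⊎ F x y
      flip (inj₁ f) = inj₂ f
      flip (inj₂ f) = inj₁ f

  walk-map : {ok ok′ : Node → Set} {F F′ : Node → Node → Set} →
             (∀ z → ok z → ok′ z) → (∀ u v → F u v → F′ u v) → Walk E ok F x y → Walk E ok′ F′ x y
  walk-map fo ff (here o)             = here (fo _ o)
  walk-map fo ff (step o (inj₁ f) ω)  = step (fo _ o) (inj₁ (ff _ _ f)) (walk-map fo ff ω)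
  walk-map fo ff (step o (inj₂ f) ω)  = step (fo _ o) (inj₂ (ff _ _ f)) (walk-map fo ff ω)

  mkCycle : ∀ {A B} → Path t A h → Path t B h → Disjoint A B → ¬ (A ≡ [] × B ≡ []) → ReticulationCycle E
  mkCycle {t} {h} {A} {B} π₁ π₂ apart nontrivial = record
    { split = t ; end = h ; path₁ = A ; path₂ = B
    ; isPath₁ = fromPath π₁ ; isPath₂ = fromPath π₂
    ; distinct = distinct′ A B apart nontrivial ; disjoint = apart }
    where
    distinct′ : ∀ A B → Disjoint A B → ¬ (A ≡ [] × B ≡ []) → A ≢ B
    distinct′ []      []       _     nt refl = nt (refl , refl)
    distinct′ (x ∷ A) .(x ∷ A) apart _  refl = apart x (here refl) (here refl)

  record LastIn (L : List Node) (x : Node) (M : List Node) (p : Node) : Set where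
    field
      last      : Node
      rest      : List Node
      rest-route : Route last rest p
      last∈     : last ∈ L
      rest-free : Disjoint rest L
      covers    : ∀ y → y ∈ (x ∷ M) → y ∈ rest ⊎ Reach y last
      reached   : Reach x last

  last-in : (L : List Node) → Route x M p → LastIn L x M p ⊎ Disjoint (x ∷ M) L
  last-in {x} L stop with x ∈? L
  ... | yes m = inj₁ (record { last = x ; rest = [] ; rest-route = stop ; last∈ = m
                             ; rest-free = λ _ () ; covers = covers ; reached = reach-refl })
    where
    covers : ∀ y → y ∈ (x ∷ []) → y ∈ [] ⊎ Reach y x
    covers y (here refl) = inj₂ reach-refl
  ... | no x∉L = inj₂ λ { y (here refl) m → x∉L m }
  last-in {x} {b ∷ M} L (go e r) with last-in L r
  ... | inj₁ later = inj₁ (record { last = last ; rest = rest ; rest-route = rest-route ; last∈ = last∈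
                                  ; rest-free = rest-free ; covers = covers′ ; reached = reach-trans (reach-arc e) reached })
    where
    open LastIn later
    covers′ : ∀ y → y ∈ (x ∷ b ∷ M) → y ∈ rest ⊎ Reach y last
    covers′ y (here refl) = inj₂ (reach-trans (reach-arc e) reached)
    covers′ y (there m)   = covers y m
  ... | inj₂ none with x ∈? L
  ...   | yes m = inj₁ (record { last = x ; rest = b ∷ M ; rest-route = go e r ; last∈ = m
                               ; rest-free = none ; covers = covers ; reached = reach-refl })
    where
    covers : ∀ y → y ∈ (x ∷ b ∷ M) → y ∈ (b ∷ M) ⊎ Reach y x
    covers y (here refl) = inj₂ reach-refl
    covers y (there m′)  = inj₁ m′
  ...   | no x∉L = inj₂ λ { y (here refl) m′ → x∉L m′ ; y (there m) m′ → none y m m′ }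

  record Fork (a : Node) (M₁ : List Node) (p₁ : Node) (M₂ : List Node) (p₂ : Node) : Set where
    field
      top     : Node
      N₁ N₂   : List Node
      ρ₁      : Route top N₁ p₁
      ρ₂      : Route top N₂ p₂
      apart   : Disjoint N₁ N₂
      covers₁ : ∀ y → y ∈ (a ∷ M₁) → y ∈ N₁ ⊎ Reach y top
      covers₂ : ∀ y → y ∈ (a ∷ M₂) → y ∈ N₂ ⊎ Reach y top

  fork : ∀ {M₁ M₂} → Route a M₁ p₁ → Route a M₂ p₂ → Fork a M₁ p₁ M₂ p₂
  fork {a} {M₂ = M₂} r₁ r₂ with last-in (a ∷ M₂) r₁
  ... | inj₂ none = ⊥-elim (none a (here refl) (here refl))
  ... | inj₁ li with route-cut r₂ (LastIn.last∈ li)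
  ...   | N′ , r′ , covers′ , sub = record
          { top = last ; N₁ = rest ; N₂ = N′ ; ρ₁ = rest-route ; ρ₂ = r′
          ; apart = λ y m₁ m₂ → rest-free y m₁ (there (sub m₂))
          ; covers₁ = covers ; covers₂ = covers′ }
    where open LastIn li

  record CycleAt (x₁ p₁ x₂ p₂ h : Node) : Set where
    field
      top        : Node
      N₁ N₂      : List Node
      ρ₁         : Route top N₁ p₁
      ρ₂         : Route top N₂ p₂
      e₁         : Arc E p₁ h
      e₂         : Arc E p₂ h
      apart      : Disjoint N₁ N₂
      nontrivial : ¬ (N₁ ≡ [] × N₂ ≡ [])
      via₁       : x₁ ∈ N₁ ⊎ Reach x₁ top
      via₂       : x₂ ∈ N₂ ⊎ Reach x₂ top

    cycle : ReticulationCycle E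
    cycle = mkCycle (route+arc ρ₁ e₁) (route+arc ρ₂ e₂) apart nontrivial

    on₁ : y ∈ N₁ → y ∈ intermediate cycle
    on₁ = ∈-++⁺ˡ
    on₂ : y ∈ N₂ → y ∈ intermediate cycle
    on₂ = ∈-++⁺ʳ N₁

    reach₁ : Reach top p₁
    reach₁ = N₁ , ρ₁

  cycle-at : Reach a x₁ → Reach x₁ p₁ → Reach a x₂ → Reach x₂ p₂ →
             Arc E p₁ h → Arc E p₂ h → p₁ ≢ p₂ → CycleAt x₁ p₁ x₂ p₂ h
  cycle-at ra₁ r₁ ra₂ r₂ e₁ e₂ p₁≢p₂ = record
    { top = top ; N₁ = N₁ ; N₂ = N₂ ; ρ₁ = ρ₁ ; ρ₂ = ρ₂ ; e₁ = e₁ ; e₂ = e₂ ; apart = apart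
    ; nontrivial = nontrivial ; via₁ = covers₁ _ (visited ra₁ r₁) ; via₂ = covers₂ _ (visited ra₂ r₂) }
    where
    visited : (ra : Reach a x) (r : Reach x p) → x ∈ (a ∷ (proj₁ ra ++ proj₁ r))
    visited (M , r) (K , r′) with route-end∈ r
    ... | here refl = here refl
    ... | there m   = there (∈-++⁺ˡ m)
    open Fork (fork (proj₂ ra₁ ++ᴿ proj₂ r₁) (proj₂ ra₂ ++ᴿ proj₂ r₂))
    nontrivial : ¬ (N₁ ≡ [] × N₂ ≡ [])
    nontrivial (eq₁ , eq₂) =
      p₁≢p₂ (trans (sym (route-[] (subst (λ L → Route top L _) eq₁ ρ₁)))
                   (route-[] (subst (λ L → Route top L _) eq₂ ρ₂)))

  module _ (C : ReticulationCycle E) where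
    branch₁ : Path (split C) (path₁ C) (end C)
    branch₁ = toPath _ (isPath₁ C)

    branch₂ : Path (split C) (path₂ C) (end C)
    branch₂ = toPath _ (isPath₂ C)

    -- A cycle seen from one of its two branches (A), the other being B.
    record Side : Set where
      field
        A B   : List Node
        πA    : Path (split C) A (end C)
        πB    : Path (split C) B (end C)
        apart : Disjoint A B
        A⊆    : A ⊆ intermediate C
        B⊆    : B ⊆ intermediate C

    side₁ side₂ : Side
    side₁ = record { A = path₁ C ; B = path₂ C ; πA = branch₁ ; πB = branch₂
                   ; apart = disjoint C ; A⊆ = ∈-++⁺ˡ ; B⊆ = ∈-++⁺ʳ (path₁ C) }
    side₂ = record { A = path₂ C ; B = path₁ C ; πA = branch₂ ; πB = branch₁
                   ; apart = λ y m₁ m₂ → disjoint C y m₂ m₁ ; A⊆ = ∈-++⁺ʳ (path₁ C) ; B⊆ = ∈-++⁺ˡ }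

    side-of : x ∈ intermediate C → Σ Side λ σ → x ∈ Side.A σ
    side-of m with ∈-++⁻ (path₁ C) m
    ... | inj₁ m₁ = side₁ , m₁
    ... | inj₂ m₂ = side₂ , m₂

    intermediate-reach : x ∈ intermediate C → Reach⁺ (split C) x × Reach⁺ x (end C)
    intermediate-reach m with side-of m
    ... | σ , mA = path-visit (Side.πA σ) mA

    intermediate-head : x ∈ intermediate C → Σ Node λ c → Arc E (split C) c × c ∈ intermediate C × Reach c x
    intermediate-head m with side-of m
    ... | σ , mA with path-head (Side.πA σ) mA
    ...   | c , e , cm , r = c , e , Side.A⊆ σ cm , r

    -- the branches differ, so one is non-trivial and the cycle has an intermediate node
    some-intermediate : Σ Node λ x → x ∈ intermediate C
    some-intermediate = pick (path₁ C) (path₂ C) (distinct C) ∈-++⁺ˡ (∈-++⁺ʳ (path₁ C))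
      where
      pick : ∀ A B → A ≢ B → A ⊆ intermediate C → B ⊆ intermediate C → Σ Node λ x → x ∈ intermediate C
      pick (x ∷ _) _       _  A⊆ _  = x , A⊆ (here refl)
      pick []      (x ∷ _) _  _  B⊆ = x , B⊆ (here refl)
      pick []      []      ne _  _  = ⊥-elim (ne refl)

    cycle-head : Σ Node λ c → Arc E (split C) c × c ∈ intermediate C × Reach c (end C)
    cycle-head with some-intermediate
    ... | x , m with intermediate-head m
    ...   | c , e , cm , r = c , e , cm , reach-trans r (reach⁺⇒reach (proj₂ (intermediate-reach m)))

  OnPath : Node → List Node → Node → Node → Set
  OnPath a xs b y = y ≡ a ⊎ y ∈ xs ⊎ y ≡ b

  data PathArc : Node → List Node → Node → Node → Node → Set where
    last-arc  : PathArc a [] b a b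
    first-arc : PathArc a (x ∷ xs) b a x
    later-arc : PathArc x xs b u v → PathArc a (x ∷ xs) b u v

  path-arc : Path a xs b → PathArc a xs b u v → Arc E u v
  path-arc (single e) last-arc      = e
  path-arc (cons e r) first-arc     = e
  path-arc (cons e r) (later-arc o) = path-arc r o

  on-tail : OnPath x xs b y → OnPath a (x ∷ xs) b y
  on-tail (inj₁ refl)        = inj₂ (inj₁ (here refl))
  on-tail (inj₂ (inj₁ m))    = inj₂ (inj₁ (there m))
  on-tail (inj₂ (inj₂ refl)) = inj₂ (inj₂ refl)

  on-tail⁻ : y ∈ (x ∷ xs) ⊎ y ≡ b → OnPath x xs b y
  on-tail⁻ (inj₁ (here refl)) = inj₁ refl
  on-tail⁻ (inj₁ (there m))   = inj₂ (inj₁ m)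
  on-tail⁻ (inj₂ refl)        = inj₂ (inj₂ refl)

  path-arc-ends : PathArc a xs b u v → OnPath a xs b u × OnPath a xs b v
  path-arc-ends last-arc      = inj₁ refl , inj₂ (inj₂ refl)
  path-arc-ends first-arc     = inj₁ refl , inj₂ (inj₁ (here refl))
  path-arc-ends (later-arc o) = on-tail (proj₁ (path-arc-ends o)) , on-tail (proj₂ (path-arc-ends o))

  module _ {ok : Node → Set} {F : Node → Node → Set} where
    walk-along : Path a xs b → (∀ u v → PathArc a xs b u v → F u v) → (∀ y → OnPath a xs b y → ok y) →
                 OnPath a xs b y → Walk E ok F a y
    walk-along π        fs os (inj₁ refl) = here (os _ (inj₁ refl))
    walk-along (single e) fs os (inj₂ (inj₂ refl)) =
      walk-edge (os _ (inj₁ refl)) (os _ (inj₂ (inj₂ refl))) (inj₁ (fs _ _ last-arc))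
    walk-along (cons e r) fs os (inj₂ y∈) =
      walk-edge (os _ (inj₁ refl)) (os _ (inj₂ (inj₁ (here refl)))) (inj₁ (fs _ _ first-arc))
      ++ᵂ walk-along r (λ u v o → fs u v (later-arc o)) (λ z o → os z (on-tail o)) (on-tail⁻ y∈)

    walk-to-end : Path a xs b → (∀ u v → PathArc a xs b u v → F u v) → (∀ y → OnPath a xs b y → ok y) →
                  OnPath a xs b y → Walk E ok F y b
    walk-to-end π fs os o = walk-reverse (walk-along π fs os o) ++ᵂ walk-along π fs os (inj₂ (inj₂ refl))

  module _ {V₁ V₂ : Node → Set} {F₁ F₂ : Node → Node → Set} where
    private
      V : Node → Set
      V z = V₁ z ⊎ V₂ z
      F : Node → Node → Set
      F u v = F₁ u v ⊎ F₂ u v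

      lift₁ : ∀ {P : Node → Set} → Walk E (λ z → V₁ z × P z) F₁ x y → Walk E (λ z → V z × P z) F x y
      lift₁ = walk-map (λ _ o → inj₁ (proj₁ o) , proj₂ o) (λ _ _ → inj₁)
      lift₂ : ∀ {P : Node → Set} → Walk E (λ z → V₂ z × P z) F₂ x y → Walk E (λ z → V z × P z) F x y
      lift₂ = walk-map (λ _ o → inj₂ (proj₁ o) , proj₂ o) (λ _ _ → inj₂)

      glue : ∀ {P : Node → Set} → Connected E (λ z → V₁ z × P z) F₁ → Connected E (λ z → V₂ z × P z) F₂ →
             V₁ c → V₂ c → P c → Connected E (λ z → V z × P z) F
      glue k₁ k₂ c₁ c₂ pc x y (inj₁ x₁ , px) (inj₁ y₁ , py) = lift₁ (k₁ x y (x₁ , px) (y₁ , py))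
      glue k₁ k₂ c₁ c₂ pc x y (inj₂ x₂ , px) (inj₂ y₂ , py) = lift₂ (k₂ x y (x₂ , px) (y₂ , py))
      glue k₁ k₂ c₁ c₂ pc x y (inj₁ x₁ , px) (inj₂ y₂ , py) =
        lift₁ (k₁ x _ (x₁ , px) (c₁ , pc)) ++ᵂ lift₂ (k₂ _ y (c₂ , pc) (y₂ , py))
      glue k₁ k₂ c₁ c₂ pc x y (inj₂ x₂ , px) (inj₁ y₁ , py) =
        lift₂ (k₂ x _ (x₂ , px) (c₂ , pc)) ++ᵂ lift₁ (k₁ _ y (c₁ , pc) (y₁ , py))

      trivially : ∀ {W : Node → Set} {G : Node → Node → Set} → Connected E W G → Connected E (λ z → W z × ⊤) G
      trivially k x y (wx , _) (wy , _) = walk-map (λ _ o → o , tt) (λ _ _ f → f) (k x y wx wy)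

    union-subgraph : IsSubgraph E V₁ F₁ → IsSubgraph E V₂ F₂ → IsSubgraph E V F
    union-subgraph s₁ s₂ u v (inj₁ f) with s₁ u v f
    ... | e , Vu , Vv = e , inj₁ Vu , inj₁ Vv
    union-subgraph s₁ s₂ u v (inj₂ f) with s₂ u v f
    ... | e , Vu , Vv = e , inj₂ Vu , inj₂ Vv

    union-biconnected : Biconnected E V₁ F₁ → Biconnected E V₂ F₂ → a ≢ b →
                        V₁ a → V₁ b → V₂ a → V₂ b → Biconnected E V F
    union-biconnected {a} (k₁ , κ₁) (k₂ , κ₂) a≢b a₁ b₁ a₂ b₂ =
      (λ x y vx vy → walk-map (λ _ → proj₁) (λ _ _ f → f)
                       (glue (trivially k₁) (trivially k₂) a₁ a₂ tt x y (vx , tt) (vy , tt))) ,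
      λ w → avoiding w (a ≟ᶠ w)
      where
      avoiding : ∀ w → Dec (a ≡ w) → Connected E (λ z → V z × z ≢ w) F
      avoiding w (yes refl) = glue (κ₁ w) (κ₂ w) b₁ b₂ (λ eq → a≢b (sym eq))
      avoiding w (no a≢w)   = glue (κ₁ w) (κ₂ w) a₁ a₂ a≢w

  other-parent : Hybrid E h → (u : Node) → Σ Node λ p → u ≢ p × Arc E p h
  other-parent (a , b , a≢b , ea , eb) u with u ≟ᶠ a
  ... | yes refl = b , a≢b , eb
  ... | no u≢a   = a , u≢a , ea

  entering-arc : {ok : Node → Set} {F : Node → Node → Set} (P : Node → Set) →
                 (∀ x y → F x y → Arc E x y) → (∀ x y → P x → Arc E x y → P y) →
                 Walk E ok F a b → P a → ¬ P b →
                 ¬ ¬ (Σ Node λ x → Σ Node λ y → Arc E x y × P y × ¬ P x × ok x)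
  entering-arc P arcs closed (here _) Pa ¬Pb _ = ¬Pb Pa
  entering-arc P arcs closed (step {x} {y} _ (inj₁ f) ω) Px ¬Pb =
    entering-arc P arcs closed ω (closed x y Px (arcs x y f)) ¬Pb
  entering-arc P arcs closed (step {x} {y} _ (inj₂ f) ω) Px ¬Pb found =
    ¬¬-excluded-middle λ
      { (yes Py) → entering-arc P arcs closed ω Py ¬Pb found
      ; (no ¬Py) → found (y , x , arcs y x f , Px , ¬Py , walk-start ω) }

  module DAG (acyclic : Acyclic E) where

    route-not-closed : Route a (b ∷ M) a → ⊥
    route-not-closed r = acyclic _ (proj₁ (route⇒path r)) (proj₂ (route⇒path r))

    no-return : Reach⁺ a b → Reach b a → ⊥
    no-return (x , M , r) (K , r′) = route-not-closed (r ++ᴿ r′)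

    reach-antisym : Reach a b → Reach b a → a ≡ b
    reach-antisym ([] , r)    _  = route-[] r
    reach-antisym (x ∷ M , r) r′ = ⊥-elim (no-return (x , M , r) r′)

    reach⁺-irrefl : Reach⁺ a a → ⊥
    reach⁺-irrefl r = no-return r reach-refl

    path-start≢end : Path a xs b → a ≢ b
    path-start≢end π refl = reach⁺-irrefl (path⇒reach⁺ π)

    path-end∉ : Path a xs b → y ∈ xs → b ≢ y
    path-end∉ π m refl = reach⁺-irrefl (proj₂ (path-visit π m))

    intermediate≢end : (C : ReticulationCycle E) → x ∈ intermediate C → x ≢ end C
    intermediate≢end C m refl = reach⁺-irrefl (proj₂ (intermediate-reach C m))

    -- the end of a cycle is hybrid: its two branches enter it from distinct nodes
    end-hybrid : (C : ReticulationCycle E) → Hybrid E (end C)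
    end-hybrid C with path-last (branch₁ C) | path-last (branch₂ C)
    ... | q₁ , _ , e₁ , w₁ | q₂ , _ , e₂ , w₂ = q₁ , q₂ , differ w₁ w₂ , e₁ , e₂
      where
      differ : (q₁ ≡ split C × path₁ C ≡ []) ⊎ q₁ ∈ path₁ C →
               (q₂ ≡ split C × path₂ C ≡ []) ⊎ q₂ ∈ path₂ C → q₁ ≢ q₂
      differ (inj₁ (_ , e₁)) (inj₁ (_ , e₂)) _    = distinct C (trans e₁ (sym e₂))
      differ (inj₁ (refl , _)) (inj₂ m)     refl = reach⁺-irrefl (proj₁ (path-visit (branch₂ C) m))
      differ (inj₂ m) (inj₁ (refl , _))     refl = reach⁺-irrefl (proj₁ (path-visit (branch₁ C) m))
      differ (inj₂ m) (inj₂ m′)             refl = disjoint C _ m m′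

    -- Rerouting a cycle D: a route t ⇝ p with an arc p → v into a branch A
    -- of D, continued along A, and a route t ⇝ split D continued along the
    -- other branch B, form a cycle ending at end D as soon as the two new
    -- routes share no node and the first avoids B.
    detour : ∀ {post L₁ L₀} (D : ReticulationCycle E) (σ : Side D) → v ∈ Side.A σ → Path v post (end D) →
             post ⊆ Side.A σ → Route t L₁ p → Arc E p v → Route t L₀ (split D) →
             Disjoint L₁ L₀ → Disjoint L₁ (Side.B σ) → ReticulationCycle E
    detour {v} {post = post} {L₁} {L₀} D σ v∈A π-post post⊆A ρ₁ e ρ₀ L₁∩L₀ L₁∩B =
      mkCycle (route+path ρ₁ (cons e π-post)) (route+path ρ₀ (Side.πB σ)) apart nontrivial
      where
      on-A : y ∈ (v ∷ post) → y ∈ Side.A σ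
      on-A (here refl) = v∈A
      on-A (there m)   = post⊆A m
      apart : Disjoint (L₁ ++ v ∷ post) (L₀ ++ Side.B σ)
      apart y m₁ m₂ with ∈-++⁻ L₁ m₁ | ∈-++⁻ L₀ m₂
      ... | inj₁ a₁ | inj₁ b₀ = L₁∩L₀ y a₁ b₀
      ... | inj₁ a₁ | inj₂ b  = L₁∩B y a₁ b
      ... | inj₂ a  | inj₁ b₀ = no-return (proj₁ (path-visit (Side.πA σ) (on-A a))) (proj₂ (route-visit ρ₀ b₀))
      ... | inj₂ a  | inj₂ b  = Side.apart σ y (on-A a) b
      nontrivial : ¬ (L₁ ++ v ∷ post ≡ [] × L₀ ++ Side.B σ ≡ [])
      nontrivial (eq , _) = nonempty L₁ eq
        where
        nonempty : ∀ L → ¬ (L ++ v ∷ post ≡ [])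
        nonempty []      ()
        nonempty (_ ∷ _) ()

    escape : ∀ {Q : Node → Set} {F : Node → Node → Set} → Path a xs b →
             (∀ u v → PathArc a xs b u v → F u v) → (∀ y → OnPath a xs b y → Q y) → OnPath a xs b y → y ≢ w →
             Walk E (λ z → Q z × z ≢ w) F y a ⊎ Walk E (λ z → Q z × z ≢ w) F y b
    escape π          fs os (inj₁ refl)        y≢w = inj₁ (here (os _ (inj₁ refl) , y≢w))
    escape π          fs os (inj₂ (inj₂ refl)) y≢w = inj₂ (here (os _ (inj₂ (inj₂ refl)) , y≢w))
    escape {a} {w = w} (cons e r) fs os (inj₂ (inj₁ y∈)) y≢w
      with escape r (λ u v o → fs u v (later-arc o)) (λ z o → os z (on-tail o)) (on-tail⁻ (inj₁ y∈)) y≢w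
    ... | inj₂ ω = inj₂ ω
    ... | inj₁ ω with a ≟ᶠ w
    ...   | no a≢w   = inj₁ (ω ++ᵂ walk-edge (walk-end ω) (os _ (inj₁ refl) , a≢w) (inj₂ (fs _ _ first-arc)))
    ...   | yes refl = inj₂ (walk-to-end r (λ u v o → fs u v (later-arc o)) (λ z o → os z (on-tail o) , after-start o)
                                         (on-tail⁻ (inj₁ y∈)))
      where
      after-start : OnPath _ _ _ z → z ≢ a
      after-start (inj₁ refl)        refl = reach⁺-irrefl (reach⁺-arc e)
      after-start (inj₂ (inj₁ m))    refl = no-return (reach⁺-arc e) (reach⁺⇒reach (proj₁ (path-visit r m)))
      after-start (inj₂ (inj₂ refl)) refl = no-return (reach⁺-arc e) (reach⁺⇒reach (path⇒reach⁺ r))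

    module CycleSubgraph (C : ReticulationCycle E) where
      VC : Node → Set
      VC y = OnPath (split C) (path₁ C) (end C) y ⊎ OnPath (split C) (path₂ C) (end C) y

      FC : Node → Node → Set
      FC u v = PathArc (split C) (path₁ C) (end C) u v ⊎ PathArc (split C) (path₂ C) (end C) u v

      subgraph : IsSubgraph E VC FC
      subgraph u v (inj₁ o) = path-arc (branch₁ C) o , inj₁ (proj₁ (path-arc-ends o)) , inj₁ (proj₂ (path-arc-ends o))
      subgraph u v (inj₂ o) = path-arc (branch₂ C) o , inj₂ (proj₁ (path-arc-ends o)) , inj₂ (proj₂ (path-arc-ends o))

      split∈ : VC (split C)
      split∈ = inj₁ (inj₁ refl)

      end∈ : VC (end C)
      end∈ = inj₁ (inj₂ (inj₂ refl))

      intermediate∈ : x ∈ intermediate C → VC x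
      intermediate∈ m with ∈-++⁻ (path₁ C) m
      ... | inj₁ m₁ = inj₁ (inj₂ (inj₁ m₁))
      ... | inj₂ m₂ = inj₂ (inj₂ (inj₁ m₂))

      intermediate-pred : x ∈ intermediate C → Σ Node λ p → Arc E p x × VC p
      intermediate-pred m with ∈-++⁻ (path₁ C) m
      ... | inj₁ m₁ with path-pred (branch₁ C) m₁
      ...   | p , e , inj₁ refl = p , e , inj₁ (inj₁ refl)
      ...   | p , e , inj₂ pm   = p , e , inj₁ (inj₂ (inj₁ pm))
      intermediate-pred m | inj₂ m₂ with path-pred (branch₂ C) m₂
      ...   | p , e , inj₁ refl = p , e , inj₂ (inj₁ refl)
      ...   | p , e , inj₂ pm   = p , e , inj₂ (inj₂ (inj₁ pm))

      connected : Connected E VC FC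
      connected x y vx vy = walk-reverse (from-split vx) ++ᵂ from-split vy
        where
        from-split : ∀ {z} → VC z → Walk E VC FC (split C) z
        from-split (inj₁ o) = walk-along (branch₁ C) (λ _ _ → inj₁) (λ _ → inj₁) o
        from-split (inj₂ o) = walk-along (branch₂ C) (λ _ _ → inj₂) (λ _ → inj₂) o

      -- Removing any node w keeps the cycle connected: every other node
      -- escapes to the split or the end, and these two are joined by the
      -- branch not containing w.
      connected-without : ∀ w → Connected E (λ z → VC z × z ≢ w) FC
      connected-without w x y (vx , x≢w) (vy , y≢w) = join (escape′ vx x≢w) (escape′ vy y≢w)
        where
        Avoid : Node → Set
        Avoid z = VC z × z ≢ w

        escape′ : ∀ {z} → VC z → z ≢ w → Walk E Avoid FC z (split C) ⊎ Walk E Avoid FC z (end C)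
        escape′ (inj₁ o) z≢w = escape (branch₁ C) (λ _ _ → inj₁) (λ _ → inj₁) o z≢w
        escape′ (inj₂ o) z≢w = escape (branch₂ C) (λ _ _ → inj₂) (λ _ → inj₂) o z≢w

        around : split C ≢ w → end C ≢ w → Walk E Avoid FC (split C) (end C)
        around s≢w e≢w with w ∈? path₁ C
        ... | yes w∈₁ = walk-to-end (branch₂ C) (λ _ _ → inj₂) (λ y o → inj₂ o , avoids o) (inj₁ refl)
          where
          avoids : ∀ {z} → OnPath (split C) (path₂ C) (end C) z → z ≢ w
          avoids (inj₁ refl)        = s≢w
          avoids (inj₂ (inj₁ m))    refl = disjoint C _ w∈₁ m
          avoids (inj₂ (inj₂ refl)) = e≢w
        ... | no w∉₁ = walk-to-end (branch₁ C) (λ _ _ → inj₁) (λ y o → inj₁ o , avoids o) (inj₁ refl)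
          where
          avoids : ∀ {z} → OnPath (split C) (path₁ C) (end C) z → z ≢ w
          avoids (inj₁ refl)        = s≢w
          avoids (inj₂ (inj₁ m))    refl = w∉₁ m
          avoids (inj₂ (inj₂ refl)) = e≢w

        join : Walk E Avoid FC x (split C) ⊎ Walk E Avoid FC x (end C) →
               Walk E Avoid FC y (split C) ⊎ Walk E Avoid FC y (end C) → Walk E Avoid FC x y
        join (inj₁ ωx) (inj₁ ωy) = ωx ++ᵂ walk-reverse ωy
        join (inj₂ ωx) (inj₂ ωy) = ωx ++ᵂ walk-reverse ωy
        join (inj₁ ωx) (inj₂ ωy) = ωx ++ᵂ (around (proj₂ (walk-end ωx)) (proj₂ (walk-end ωy)) ++ᵂ walk-reverse ωy)
        join (inj₂ ωx) (inj₁ ωy) =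
          ωx ++ᵂ (walk-reverse (around (proj₂ (walk-end ωy)) (proj₂ (walk-end ωx))) ++ᵂ walk-reverse ωy)

      biconnected : Biconnected E VC FC
      biconnected = connected , connected-without

    -- Level-1 networks are 1-nested and have no hybrid split: the subgraph
    -- of a cycle (or of two cycles sharing an intermediate node and its
    -- parent) is biconnected and would contain two hybrid nodes.
    level1⇒ : Level1 E → OneNested E × NoHybridSplit E
    level1⇒ level1 = one-nested , no-hybrid-split
      where
      no-hybrid-split : NoHybridSplit E
      no-hybrid-split C split-hybrid =
        level1 VC FC subgraph biconnected (split C) (end C) (path-start≢end (branch₁ C))
               split-hybrid (end-hybrid C) split∈ end∈
        where open CycleSubgraph C
      one-nested : OneNested E
      one-nested C D ends x x∈C x∈D with CycleSubgraph.intermediate-pred C x∈C | CycleSubgraph.intermediate-pred D x∈D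
      ... | p , e , p∈C | p′ , e′ , p′∈D with p ≟ᶠ p′
      ...   | no p≢p′ =
        level1 VC FC subgraph biconnected x (end C) (intermediate≢end C x∈C)
               (p , p′ , p≢p′ , e , e′) (end-hybrid C) (intermediate∈ x∈C) end∈
        where open CycleSubgraph C
      ...   | yes refl =
        level1 _ _ (union-subgraph (CycleSubgraph.subgraph C) (CycleSubgraph.subgraph D))
               (union-biconnected (CycleSubgraph.biconnected C) (CycleSubgraph.biconnected D) x≢p
                                  (CycleSubgraph.intermediate∈ C x∈C) p∈C (CycleSubgraph.intermediate∈ D x∈D) p′∈D)
               (end C) (end D) ends (end-hybrid C) (end-hybrid D) (inj₁ (CycleSubgraph.end∈ C)) (inj₂ (CycleSubgraph.end∈ D))
        where
        x≢p : x ≢ p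
        x≢p refl = reach⁺-irrefl (reach⁺-arc e)

    module RootedDAG (root : Node) (isRoot : IsRoot E root) where

      root-reach : ∀ v → Reach root v
      root-reach v with proj₂ isRoot v
      ... | inj₁ refl     = reach-refl
      ... | inj₂ (xs , π) = _ , path⇒route (toPath xs π)

      nothing-above-root : Reach⁺ a root → ⊥
      nothing-above-root (x , M , r) with route-last r
      ... | _ , p , _ , e = proj₁ isRoot p e

      -- two parents of a hybrid node close a reticulation cycle ending at it
      hybrid-cycle : Hybrid E h → Σ (ReticulationCycle E) λ C → end C ≡ h
      hybrid-cycle (a , b , a≢b , ea , eb) =
        CycleAt.cycle (cycle-at (root-reach a) reach-refl (root-reach b) reach-refl ea eb a≢b) , refl

      module Converse (one-nested : OneNested E) (no-hybrid-split : NoHybridSplit E) where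

        nested : (C D : ReticulationCycle E) → end C ≢ end D → x ∈ intermediate C → x ∈ intermediate D → ⊥
        nested C D ends m₁ m₂ = one-nested C D ends _ m₁ m₂

        Source : Node → Node → Set
        Source h z = z ≡ h ⊎ Σ (ReticulationCycle E) λ C → end C ≡ h × z ∈ intermediate C

        Zone : Node → Node → Set
        Zone h v = Σ Node λ z → Source h z × Reach z v

        zone-self : Zone h h
        zone-self = _ , inj₁ refl , reach-refl

        zone-step : Zone h v → Reach v w → Zone h w
        zone-step (z , src , r) r′ = z , src , reach-trans r r′

        zone-cycle : (C : ReticulationCycle E) → end C ≡ h → x ∈ intermediate C → Zone h x
        zone-cycle C eq m = _ , inj₂ (C , eq , m) , reach-refl

        zone-closed : ∀ x y → Zone h x → Arc E x y → Zone h y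
        zone-closed x y zx e = zone-step zx (reach-arc e)

        source-head : Hybrid E h → Source h z →
                      Σ (ReticulationCycle E) λ C → end C ≡ h ×
                        Σ Node λ c → Arc E (split C) c × c ∈ intermediate C × Reach c z
        source-head hyb (inj₁ refl) with hybrid-cycle hyb
        ... | C , eq with cycle-head C
        ...   | c , e , m , r = C , eq , c , e , m , subst (Reach c) eq r
        source-head hyb (inj₂ (C , eq , m)) with intermediate-head C m
        ... | c , e , cm , r = C , eq , c , e , cm , r

        pinned : ∀ {N} (Z : ReticulationCycle E) → end Z ≡ h → N ⊆ intermediate Z →
                 Route t N u → u ∈ N ⊎ Reach u t → ¬ Zone h u → t ≡ u
        pinned Z eq sub ρ (inj₁ u∈) u∉ = ⊥-elim (u∉ (zone-cycle Z eq (sub u∈)))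
        pinned Z eq sub ρ (inj₂ r)  u∉ = reach-antisym (_ , ρ) r

        splits-at-outside : (Y : CycleAt u u x₂ p₂ h) → ¬ Zone h u → CycleAt.top Y ≡ u
        splits-at-outside Y = pinned (CycleAt.cycle Y) refl (CycleAt.on₁ Y) (CycleAt.ρ₁ Y) (CycleAt.via₁ Y)

        -- An arc u → v from outside the zone of end C into a branch of C at a
        -- child v of the split: rerouting C through the branch via u of a cycle
        -- Y closing at v gives a cycle ending at end C and splitting at u.
        enter-first : ∀ {post} (C : ReticulationCycle E) (σ : Side C) → v ∈ Side.A σ → Path v post (end C) →
                      post ⊆ Side.A σ → Arc E u v → ¬ Zone (end C) u → CycleAt u u (split C) (split C) v →
                      Σ (ReticulationCycle E) λ C′ → end C′ ≡ end C × split C′ ≡ u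
        enter-first C σ v∈A π-post post⊆A e u∉ Y =
          Z , refl , pinned Z refl (λ m → ∈-++⁺ˡ (∈-++⁺ˡ m)) ρ₁ via₁ u∉
          where
          open CycleAt Y
          Z : ReticulationCycle E
          Z = detour C σ v∈A π-post post⊆A ρ₁ e ρ₂ apart
                λ y m₁ m₂ → u∉ (zone-step (zone-cycle C refl (Side.B⊆ σ m₂)) (proj₂ (route-visit ρ₁ m₁)))

        enter-branch : (C : ReticulationCycle E) (σ : Side C) → v ∈ Side.A σ → Arc E u v → ¬ Zone (end C) u →
                       Σ (ReticulationCycle E) λ C′ → end C′ ≡ end C × split C′ ≡ u
        enter-branch {v} {u} C σ v∈A e u∉ with path-cut (Side.πA σ) v∈A
        ... | pre , post , π-pre , π-post , pre⊆A , post⊆A with path-last π-pre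
        ...   | q , ρ-pre , e-q , q-pos with u ≟ᶠ q
        ...     | yes refl = from-pred q-pos
          where
          from-pred : (u ≡ split C × pre ≡ []) ⊎ u ∈ pre →
                      Σ (ReticulationCycle E) λ C′ → end C′ ≡ end C × split C′ ≡ u
          from-pred (inj₁ (eq , _)) = C , refl , sym eq
          from-pred (inj₂ m)        = ⊥-elim (u∉ (zone-cycle C refl (Side.A⊆ σ (pre⊆A m))))
        ...     | no u≢q = from-pred q-pos ρ-pre e-q
          where
          from-pred : (q ≡ split C × pre ≡ []) ⊎ q ∈ pre → Route (split C) pre q → Arc E q v →
                      Σ (ReticulationCycle E) λ C′ → end C′ ≡ end C × split C′ ≡ u
          from-pred (inj₁ (refl , refl)) _ e-q′ =
            enter-first C σ v∈A π-post post⊆A e u∉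
              (cycle-at (root-reach u) reach-refl (root-reach (split C)) reach-refl e e-q′ u≢q)
          from-pred (inj₂ q∈) ρ e-q′
            with cycle-at (root-reach u) reach-refl (reach-trans (root-reach (split C)) (pre , ρ)) reach-refl e e-q′ u≢q
          ... | Y with CycleAt.via₂ Y
          ...   | inj₂ q⇝top =
            ⊥-elim (u∉ (zone-step (zone-step (zone-cycle C refl (Side.A⊆ σ (pre⊆A q∈))) q⇝top) (CycleAt.reach₁ Y)))
          ...   | inj₁ q∈N₂  = ⊥-elim (nested C (CycleAt.cycle Y) (path-end∉ (Side.πA σ) v∈A)
                                              (Side.A⊆ σ (pre⊆A q∈)) (CycleAt.on₂ Y q∈N₂))

        entry-split : Hybrid E h → Arc E u v → Zone h v → ¬ Zone h u →
                      Σ (ReticulationCycle E) λ C → end C ≡ h × split C ≡ u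
        entry-split {u = u} hyb e (z , inj₁ refl , [] , stop) u∉ with other-parent hyb u
        ... | p , u≢p , e-p with cycle-at (root-reach u) reach-refl (root-reach p) reach-refl e e-p u≢p
        ...   | Y = CycleAt.cycle Y , refl , splits-at-outside Y u∉
        entry-split hyb e (z , inj₂ (C , refl , v∈) , [] , stop) u∉ with side-of C v∈
        ... | σ , v∈A = enter-branch C σ v∈A e u∉
        entry-split {u = u} {v} hyb e (z , src , b ∷ M , r) u∉ with route-last r
        ... | M₀ , p , ρ , e-p with u ≟ᶠ p
        ...   | yes refl = ⊥-elim (u∉ (z , src , M₀ , ρ))
        ...   | no u≢p with source-head hyb src
        ...     | C , refl , c , e-c , c∈ , c⇝z
          with cycle-at (root-reach u) reach-refl (reach-trans (root-reach (split C)) (reach-arc e-c))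
                        (reach-trans c⇝z (M₀ , ρ)) e e-p u≢p
        ...       | Y with CycleAt.via₂ Y
        ...         | inj₂ c⇝top = ⊥-elim (u∉ (zone-step (zone-step (zone-cycle C refl c∈) c⇝top) (CycleAt.reach₁ Y)))
        ...         | inj₁ c∈N₂ with v ≟ᶠ end C
        ...           | no v≢h   = ⊥-elim (nested C (CycleAt.cycle Y) (λ eq → v≢h (sym eq)) c∈ (CycleAt.on₂ Y c∈N₂))
        ...           | yes refl = CycleAt.cycle Y , refl , splits-at-outside Y u∉

        Entry : Node → Node → Set
        Entry h u = ¬ Zone h u × Σ (ReticulationCycle E) λ C → end C ≡ h × split C ≡ u

        entry-not-hybrid : Entry h w → ¬ Hybrid E w
        entry-not-hybrid (_ , C , _ , refl) = no-hybrid-split C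

        route-entry : Hybrid E h → ¬ Zone h a → Route a M v → Zone h v → ¬ ¬ (Σ Node λ u → u ∈ (a ∷ M) × Entry h u)
        route-entry hyb a∉ stop v∈ _ = a∉ v∈
        route-entry {a = a} hyb a∉ (go e r) v∈ found = ¬¬-excluded-middle λ
          { (yes b∈) → found (a , here refl , a∉ , entry-split hyb e b∈ a∉)
          ; (no b∉)  → route-entry hyb b∉ r v∈ λ (u , m , en) → found (u , there m , en) }

        root-outside : Hybrid E h → ¬ Zone h root
        root-outside (a , _ , _ , e , _) (_ , inj₁ refl , [] , stop)    = proj₁ isRoot a e
        root-outside hyb (_ , inj₂ (C , _ , m) , [] , stop) = nothing-above-root (proj₁ (intermediate-reach C m))
        root-outside hyb (_ , _ , x ∷ M , r)               = nothing-above-root (x , M , r)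

        -- Two distinct nodes s, t outside the zone of h have no disjoint paths
        -- to h through the zone: with routes from the root they would close a
        -- cycle at h having s or t as intermediate node, or both as split.
        disjoint-descents : ∀ {X Y} → ¬ Zone h s → ¬ Zone h t → s ≢ t → Path s X h → Path t Y h →
                            (∀ {y} → y ∈ X → Zone h y) → (∀ {y} → y ∈ Y → Zone h y) → Disjoint X Y → ⊥
        disjoint-descents {h} {s} {t} {X} {Y} s∉ t∉ s≢t πX πY X∈ Y∈ X∩Y =
          conclude (covers₁ _ (route-end∈ (proj₂ (root-reach s)))) (covers₂ _ (route-end∈ (proj₂ (root-reach t))))
          where
          open Fork (fork (proj₂ (root-reach s)) (proj₂ (root-reach t)))
          apart′ : Disjoint (N₁ ++ X) (N₂ ++ Y)
          apart′ y m₁ m₂ with ∈-++⁻ N₁ m₁ | ∈-++⁻ N₂ m₂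
          ... | inj₁ a₁ | inj₁ b₂ = apart y a₁ b₂
          ... | inj₁ a₁ | inj₂ b₂ = s∉ (zone-step (Y∈ b₂) (proj₂ (route-visit ρ₁ a₁)))
          ... | inj₂ a₁ | inj₁ b₂ = t∉ (zone-step (X∈ a₁) (proj₂ (route-visit ρ₂ b₂)))
          ... | inj₂ a₁ | inj₂ b₂ = X∩Y y a₁ b₂
          nontrivial : ¬ (N₁ ++ X ≡ [] × N₂ ++ Y ≡ [])
          nontrivial (eq₁ , eq₂) =
            s≢t (trans (sym (route-[] (subst (λ L → Route top L s) (++-conicalˡ N₁ X eq₁) ρ₁)))
                       (route-[] (subst (λ L → Route top L t) (++-conicalˡ N₂ Y eq₂) ρ₂)))
          W : ReticulationCycle E
          W = mkCycle (route+path ρ₁ πX) (route+path ρ₂ πY) apart′ nontrivial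
          conclude : s ∈ N₁ ⊎ Reach s top → t ∈ N₂ ⊎ Reach t top → ⊥
          conclude (inj₁ m) _          = s∉ (zone-cycle W refl (∈-++⁺ˡ (∈-++⁺ˡ m)))
          conclude (inj₂ _) (inj₁ m)   = t∉ (zone-cycle W refl (∈-++⁺ʳ (N₁ ++ X) (∈-++⁺ˡ m)))
          conclude (inj₂ r₁) (inj₂ r₂) = s≢t (trans (sym (reach-antisym (N₁ , ρ₁) r₁)) (reach-antisym (N₂ , ρ₂) r₂))

        -- Two cycles ending at the same node with splits outside its zone
        -- have the same split: follow a branch of D until it meets C, and
        -- continue along C, to obtain paths contradicting disjoint-descents.
        same-split : (C D : ReticulationCycle E) → end D ≡ end C → ¬ Zone (end C) (split C) → ¬ Zone (end C) (split D) →
                     split C ≢ split D → ⊥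
        same-split C D eq sC∉ sD∉ differ with first-hit (subst (Path (split D) (path₁ D)) eq (branch₁ D)) (intermediate C)
        ... | pre , pre⊆ , pre-free , inj₁ π =
          disjoint-descents sC∉ sD∉ differ (branch₁ C) π (λ m → zone-cycle C refl (∈-++⁺ˡ m))
                            (λ m → zone-cycle D eq (∈-++⁺ˡ (pre⊆ m))) (λ y m₁ m₂ → pre-free y m₂ (∈-++⁺ˡ m₁))
        ... | pre , pre⊆ , pre-free , inj₂ (z , z∈ , π) with side-of C z∈
        ...   | σ , z∈A with path-cut (Side.πA σ) z∈A
        ...     | _ , post , _ , π-post , _ , post⊆A =
          disjoint-descents sC∉ sD∉ differ (Side.πB σ) (path+path π π-post) (λ m → zone-cycle C refl (Side.B⊆ σ m)) Y∈ apart′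
          where
          Y∈ : y ∈ (pre ++ z ∷ post) → Zone (end C) y
          Y∈ m with ∈-++⁻ pre m
          ... | inj₁ m′          = zone-cycle D eq (∈-++⁺ˡ (pre⊆ m′))
          ... | inj₂ (here refl) = zone-cycle C refl z∈
          ... | inj₂ (there m′)  = zone-cycle C refl (Side.A⊆ σ (post⊆A m′))
          apart′ : Disjoint (Side.B σ) (pre ++ z ∷ post)
          apart′ y m₁ m₂ with ∈-++⁻ pre m₂
          ... | inj₁ m′          = pre-free y m′ (Side.B⊆ σ m₁)
          ... | inj₂ (here refl) = Side.apart σ y z∈A m₁
          ... | inj₂ (there m′)  = Side.apart σ y (post⊆A m′) m₁

        entry-unique : Entry h u → Entry h w → u ≡ w
        entry-unique (u∉ , C , refl , refl) (w∉ , D , eq , refl) with split C ≟ᶠ split D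
        ... | yes same  = same
        ... | no differ = ⊥-elim (same-split C D eq u∉ w∉ differ)

        entry-exists : Hybrid E h → ¬ ¬ (Σ Node (Entry h))
        entry-exists {h} hyb none =
          route-entry hyb (root-outside hyb) (proj₂ (root-reach h)) zone-self λ (u , _ , en) → none (u , en)

        below-entry : Hybrid E h → Entry h w → Zone h x → ¬ ¬ Reach w x
        below-entry {x = x} hyb en x∈ k =
          route-entry hyb (root-outside hyb) (proj₂ (root-reach x)) x∈ λ (u , m , en′) →
            k (subst (λ r → Reach r x) (entry-unique en′ en) (proj₂ (route-visit₀ (proj₂ (root-reach x)) m)))

        -- A hybrid node h is never an intermediate node of a cycle D ending
        -- elsewhere: the parent q of h on D and another parent p close a cycle
        -- Y at h, and rerouting D through Y yields a cycle ending at end D that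
        -- shares an intermediate node with Y.
        hybrid-not-intermediate : Hybrid E h → (D : ReticulationCycle E) → h ∈ intermediate D → h ≢ end D → ⊥
        hybrid-not-intermediate {h} hyb D h∈ h≢ with side-of D h∈
        ... | σ , h∈A with path-cut (Side.πA σ) h∈A
        ...   | pre , post , π-pre , π-post , pre⊆A , post⊆A with path-last π-pre
        ...     | q , ρ-pre , e-q , q-pos with other-parent hyb q
        ...       | p , q≢p , e-p = conclude via₁ q-pos
          where
          Y : CycleAt q q p p h
          Y = cycle-at (reach-trans (root-reach (split D)) (pre , ρ-pre)) reach-refl (root-reach p) reach-refl e-q e-p q≢p
          open CycleAt Y
          open Side σ using (B; A⊆; B⊆)
          -- q is the split of D: reroute D through the branch of Y via p
          through-p : q ≡ split D → ReticulationCycle E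
          through-p eq = detour D σ h∈A π-post post⊆A ρ₂ e-p (subst (Route top N₁) eq ρ₁)
                           (λ y m₂ m₁ → apart y m₁ m₂) (λ y m₂ m → nested cycle D h≢ (on₂ m₂) (B⊆ m))

          -- Y splits at q: reroute D from q along the route q ⇝ p of Y
          from-q : top ≡ q → ReticulationCycle E
          from-q eq = detour D σ h∈A π-post post⊆A (ρ-pre ++ᴿ subst (λ r → Route r N₂ p) eq ρ₂) e-p stop
                        (λ _ _ ()) avoids-B
            where
            avoids-B : Disjoint (pre ++ N₂) B
            avoids-B y m₁ m₂ with ∈-++⁻ pre m₁
            ... | inj₁ m = Side.apart σ y (pre⊆A m) m₂
            ... | inj₂ m = nested cycle D h≢ (on₂ m) (B⊆ m₂)

          first-on : ∀ {L} → Route q L p → Σ Node λ y → y ∈ L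
          first-on stop     = ⊥-elim (q≢p refl)
          first-on (go _ _) = _ , here refl

          conclude : q ∈ N₁ ⊎ Reach q top → (q ≡ split D × pre ≡ []) ⊎ q ∈ pre → ⊥
          conclude (inj₁ q∈N₁) (inj₂ q∈pre)   = nested cycle D h≢ (on₁ q∈N₁) (A⊆ (pre⊆A q∈pre))
          conclude (inj₁ q∈N₁) (inj₁ (eq , _)) =
            nested cycle (through-p eq) h≢ (on₁ q∈N₁) (∈-++⁺ʳ (N₂ ++ h ∷ post) (∈-++⁺ˡ q∈N₁))
          conclude (inj₂ q⇝top) _ with reach-antisym (N₁ , ρ₁) q⇝top
          ... | eq with first-on (subst (λ r → Route r N₂ p) eq ρ₂)
          ...   | y , y∈ = nested cycle (from-q eq) h≢ (on₂ y∈) (∈-++⁺ˡ (∈-++⁺ˡ (∈-++⁺ʳ pre y∈)))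

        entry-child-outside : Hybrid E h → Entry h w → Arc E w c → (D : ReticulationCycle E) → c ∈ intermediate D →
                              end D ≢ h → c ≢ h → ¬ Zone h c
        entry-child-outside hyb en e-c D c∈ D≢h c≢h (z , inj₁ refl , [] , stop) = c≢h refl
        entry-child-outside hyb en e-c D c∈ D≢h c≢h (z , inj₂ (C , eq , z∈) , [] , stop) =
          nested C D (λ e → D≢h (trans (sym e) eq)) z∈ c∈
        entry-child-outside {h} {w} hyb (w∉ , _) e-c D c∈ D≢h c≢h (z , src , b ∷ M , r) with route-last r
        ... | M₀ , p , ρ , e-p with w ≟ᶠ p
        ...   | yes refl = w∉ (z , src , M₀ , ρ)
        ...   | no w≢p with cycle-at (root-reach w) reach-refl (root-reach z) (M₀ , ρ) e-c e-p w≢p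
        ...     | Y with CycleAt.via₂ Y
        ...       | inj₂ z⇝top = w∉ (zone-step (z , src , reach-refl) (reach-trans z⇝top (CycleAt.reach₁ Y)))
        ...       | inj₁ z∈N₂  = source-on-Y src
          where
          -- the source z would be intermediate in the cycle Y, which ends at c ≠ h
          source-on-Y : Source h z → ⊥
          source-on-Y (inj₁ refl) = hybrid-not-intermediate hyb (CycleAt.cycle Y) (CycleAt.on₂ Y z∈N₂) (λ e → c≢h (sym e))
          source-on-Y (inj₂ (C , eq , z∈)) =
            nested C (CycleAt.cycle Y) (λ e → c≢h (trans (sym e) eq)) z∈ (CycleAt.on₂ Y z∈N₂)

        -- The entry of h splits no cycle D ending at another node of the zone of h:
        -- the child of the entry on D would be neither inside nor outside the zone.
        entry-splits-no-other : Hybrid E h → Entry h w → (D : ReticulationCycle E) → split D ≡ w → end D ≢ h →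
                                Zone h (end D) → ⊥
        entry-splits-no-other {h} hyb en D refl D≢h D∈ with cycle-head D
        ... | c , e-c , c∈ , c⇝end = ¬¬-excluded-middle λ
          { (no c∉)  → route-entry hyb c∉ (proj₂ c⇝end) D∈ λ (u , m , en′) →
              no-return (reach⁺-arc e-c) (subst (Reach c) (entry-unique en′ en) (proj₁ (route-visit₀ (proj₂ c⇝end) m)))
          ; (yes c∈Z) → inside c∈Z }
          where
          inside : Zone h c → ⊥
          inside c∈Z with c ≟ᶠ h
          ... | yes refl = hybrid-not-intermediate hyb D c∈ (λ e → D≢h (sym e))
          ... | no c≢h   = entry-child-outside hyb en e-c D c∈ D≢h c≢h c∈Z

        -- If h′ lies in the zone of h but the entry w′ of h′ does not, both
        -- branches of the cycle splitting at w′ enter the zone of h through its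
        -- entry w; as they are disjoint, w is their common start w′.
        shared-entry : Hybrid E h → Hybrid E h′ → Entry h w → Entry h′ w′ → Zone h h′ → ¬ Zone h w′ → ¬ ¬ (w ≡ w′)
        shared-entry {w = w} hyb hyb′ enW (_ , D , refl , refl) h′∈ w′∉ k =
          route-entry hyb w′∉ (path⇒route (branch₁ D)) h′∈ λ (u₁ , m₁ , en₁) →
          route-entry hyb w′∉ (path⇒route (branch₂ D)) h′∈ λ (u₂ , m₂ , en₂) →
          conclude (locate (subst (_∈ _) (entry-unique en₁ enW) m₁)) (locate (subst (_∈ _) (entry-unique en₂ enW) m₂))
          where
          locate : ∀ {L} → w ∈ (split D ∷ (L ++ [ end D ])) → w ≡ split D ⊎ w ∈ L
          locate (here eq) = inj₁ eq
          locate {L} (there m) with ∈-++⁻ L m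
          ... | inj₁ m′        = inj₂ m′
          ... | inj₂ (here eq) = ⊥-elim (entry-not-hybrid enW (subst (Hybrid E) (sym eq) hyb′))
          conclude : w ≡ split D ⊎ w ∈ path₁ D → w ≡ split D ⊎ w ∈ path₂ D → ⊥
          conclude (inj₁ eq) _          = k eq
          conclude (inj₂ _) (inj₁ eq)   = k eq
          conclude (inj₂ m₁) (inj₂ m₂)  = disjoint D w m₁ m₂

        common-entry : Hybrid E h → Hybrid E h′ → Entry h w → Entry h′ w′ → Zone h h′ → Zone h′ h → ¬ ¬ (w ≡ w′)
        common-entry hyb hyb′ enW enW′ h′∈ h∈ k = ¬¬-excluded-middle λ
          { (no w′∉)  → shared-entry hyb hyb′ enW enW′ h′∈ w′∉ k
          ; (yes w′∈) → ¬¬-excluded-middle λ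
              { (no w∉)  → shared-entry hyb′ hyb enW′ enW h∈ w∉ λ eq → k (sym eq)
              ; (yes w∈) → below-entry hyb enW w′∈ λ w⇝w′ → below-entry hyb′ enW′ w∈ λ w′⇝w →
                             k (reach-antisym w⇝w′ w′⇝w) } }

        not-mutual : Hybrid E h → Hybrid E h′ → h ≢ h′ → Zone h h′ → Zone h′ h → ⊥
        not-mutual {h} {h′} hyb hyb′ h≢h′ h′∈ h∈ =
          entry-exists hyb λ (w , enW) → entry-exists hyb′ λ (w′ , enW′) →
          common-entry hyb hyb′ enW enW′ h′∈ h∈ λ w≡w′ → conclude enW (subst (Entry _) (sym w≡w′) enW′)
          where
          conclude : ∀ {w} → Entry h w → Entry h′ w → ⊥
          conclude enW (_ , D , eD , sD) =
            entry-splits-no-other hyb enW D sD (λ e → h≢h′ (trans (sym e) eD)) (subst (Zone h) (sym eD) h′∈)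

        -- A biconnected subgraph cannot contain a hybrid node h and a hybrid
        -- node h′ outside the zone of h: a walk from h to h′ leaves the zone
        -- through an arc from the entry u of h, and a walk avoiding u would
        -- leave it through an arc from another entry.
        zone-separates : ∀ {V F} → IsSubgraph E V F → Biconnected E V F → Hybrid E h → Hybrid E h′ →
                         V h → V h′ → ¬ Zone h h′ → ⊥
        zone-separates {h} {h′} {F = F} sub (con , con-without) hyb hyb′ Vh Vh′ h′∉ =
          entering-arc (Zone h) arcs zone-closed (con h h′ Vh Vh′) zone-self h′∉ λ (u , v , e , v∈ , u∉ , _) →
          avoiding (u∉ , entry-split hyb e v∈ u∉)
          where
          arcs : ∀ x y → F x y → Arc E x y
          arcs x y f = proj₁ (sub x y f)
          avoiding : Entry h u → ⊥
          avoiding {u} en =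
            entering-arc (Zone h) arcs zone-closed
              (con-without u h h′ (Vh , λ eq → entry-not-hybrid en (subst (Hybrid E) eq hyb))
                                  (Vh′ , λ eq → entry-not-hybrid en (subst (Hybrid E) eq hyb′)))
              zone-self h′∉ λ (u′ , v′ , e′ , v′∈ , u′∉ , (_ , u′≢u)) →
            u′≢u (entry-unique (u′∉ , entry-split hyb e′ v′∈ u′∉) en)

        level1⇐ : Level1 E
        level1⇐ V F sub bic h h′ h≢h′ hyb hyb′ Vh Vh′ = ¬¬-excluded-middle λ
          { (no h′∉)  → zone-separates sub bic hyb hyb′ Vh Vh′ h′∉
          ; (yes h′∈) → ¬¬-excluded-middle λ
              { (no h∉)  → zone-separates sub bic hyb′ hyb Vh′ Vh h∉
              ; (yes h∈) → not-mutual hyb hyb′ h≢h′ h′∈ h∈ } }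

theorem1 : (N : EvolutionaryNetwork) →
    let open EvolutionaryNetwork N in
    Level1 E ⇔ (OneNested E × NoHybridSplit E)
theorem1 N = mk⇔ level1⇒ λ (nested , no-hybrid-split) → level1⇐ nested no-hybrid-split
  where
  open EvolutionaryNetwork N
  open Digraphs.DAG E acyclic using (level1⇒)
  open Digraphs.DAG.RootedDAG.Converse E acyclic root isRoot using (level1⇐)
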